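{- Let $p$ be a prime, let $X\subseteq\mathbb{Z}/p\mathbb{Z}$, let $k$ be a positive integer and let $A$ be a $k$-atom of $X$. If there is $z\in X+A$ that can be written in exactly one way as $z=x+a$ with $x\in X$ and $a\in A$, then $|A|=k$.
   Context: For $X\subseteq\mathbb{Z}/p\mathbb{Z}$ and a positive integer $k$, the $k$-th isoperimetric number of $X$ is $$\kappa_k(X)=\min\{|S+X|-|S| : S\subseteq\mathbb{Z}/p\mathbb{Z},\ |S|\ge k,\ |S+X|\le p-k\},$$ with the convention $\min\emptyset=p$. A set $S$ attaining this minimum (with $|S|\ge k$ and $|S+X|\le p-k$) is a $k$-fragment of $X$; a $k$-fragment of minimal cardinality is a $k$-atom of $X$. -}

module Defs where

open import Data.Nat as ℕ using (ℕ; zero; suc; _≤_; _%_)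
open import Data.Nat.DivMod using (m%n<n)
open import Data.Fin using (Fin; toℕ; fromℕ<)
open import Data.Fin.Properties using (any?)
open import Data.Fin.Subset using (Subset; _∈_; ∣_∣)
open import Data.Fin.Subset.Properties using (_∈?_)
open import Data.Vec using (tabulate)
open import Data.Product using (∃; ∃₂; _×_; _,_)
open import Data.Integer as ℤ using (ℤ; +_; _-_)
open import Relation.Binary.PropositionalEquality using (_≡_)
open import Relation.Nullary.Decidable using (does; _×-dec_)
open import Data.Fin.Properties using (_≟_)

-- Addition in ℤ/nℤ, with ℤ/nℤ represented as Fin n.
_⊕_ : {n : ℕ} → Fin n → Fin n → Fin n
_⊕_ {suc n} a b = fromℕ< ((m%n<n (toℕ a ℕ.+ toℕ b) (suc n)))

_⊞_ : {n : ℕ} → Subset n → Subset n → Subset n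
S ⊞ X = tabulate λ z →
  does (any? λ s → any? λ x → (s ∈? S) ×-dec ((x ∈? X) ×-dec ((s ⊕ x) ≟ z)))

-- S is admissible for the k-th isoperimetric number:
-- |S| ≥ k and |S + X| ≤ p - k  (written |S + X| + k ≤ p).
Admissible : {p : ℕ} → Subset p → ℕ → Subset p → Set
Admissible {p} X k S = k ≤ ∣ S ∣ × ∣ S ⊞ X ∣ ℕ.+ k ≤ p

excess : {p : ℕ} → Subset p → Subset p → ℤ
excess X S = + ∣ S ⊞ X ∣ - + ∣ S ∣

IsFragment : {p : ℕ} → Subset p → ℕ → Subset p → Set
IsFragment {p} X k S =
  Admissible X k S × ((T : Subset p) → Admissible X k T → excess X S ℤ.≤ excess X T)

IsAtom : {p : ℕ} → Subset p → ℕ → Subset p → Set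
IsAtom {p} X k A =
  IsFragment X k A × ((T : Subset p) → IsFragment X k T → ∣ A ∣ ≤ ∣ T ∣)

UniqueRep : {p : ℕ} → Subset p → Subset p → Fin p → Set
UniqueRep {p} X A z =
  ∃₂ λ x a → (x ∈ X × a ∈ A × x ⊕ a ≡ z) ×
    ((x' a' : Fin p) → x' ∈ X → a' ∈ A → x' ⊕ a' ≡ z → x' ≡ x × a' ≡ a)

-- If |A| > k, delete from A the summand a of the unique representation z = x + a.
-- Then A - a is still admissible, and z leaves the sumset, so |(A - a) + X| drops by at
-- least one while |A - a| drops by exactly one: the excess does not grow, and A - a is a
-- k-fragment smaller than the atom A.
module Submission where

open import Defs
open import Data.Nat using (ℕ; _≥_)
open import Data.Nat.Primality using (Prime)
open import Data.Fin using (Fin)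
open import Data.Fin.Subset using (Subset; _∈_; ∣_∣)
open import Data.Product using (∃; _×_)
open import Relation.Binary.PropositionalEquality using (_≡_)

open import Data.Bool.Base using (true)
open import Data.Nat as ℕ using (suc; _≤_; _<_; _%_)
import Data.Nat.Properties as ℕ
open import Data.Fin using (suc; toℕ)
open import Data.Fin.Properties using (toℕ-fromℕ<; toℕ-injective; any?)
open import Data.Fin.Subset using (_⊆_; _⊂_; _∉_; _-_; inside; outside)
open import Data.Fin.Subset.Properties
  using (p⊂q⇒∣p∣<∣q∣; p─q⊆p; p─⊥≡p; x∈p⇒∣p-x∣<∣p∣)
open import Data.Integer as ℤ using (+_; +≤+)
import Data.Integer.Properties as ℤ
open import Data.Product using (_,_; ∃₂; proj₂)
open import Data.Vec using (_∷_; here; there)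
open import Data.Vec.Properties using (lookup∘tabulate; []=⇒lookup; lookup⇒[]=)
open import Function using (_∘_)
open import Relation.Nullary using (¬_; Dec; yes; no; does)
open import Relation.Nullary.Decidable using (dec-true)
open import Relation.Binary.PropositionalEquality using (refl; sym; trans; cong; subst)

private
  variable
    n : ℕ

⊕-comm : (a b : Fin n) → a ⊕ b ≡ b ⊕ a
⊕-comm {suc n} a b = toℕ-injective (trans (toℕ-fromℕ< _)
  (trans (cong (_% suc n) (ℕ.+-comm (toℕ a) (toℕ b))) (sym (toℕ-fromℕ< _))))

does≡true⇒ : {P : Set} (P? : Dec P) → does P? ≡ true → P
does≡true⇒ (yes p) _ = p
does≡true⇒ (no _) ()

∈-⊞⁻ : {S X : Subset n} {z : Fin n} → z ∈ S ⊞ X →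
  ∃₂ λ s x → s ∈ S × x ∈ X × s ⊕ x ≡ z
∈-⊞⁻ {z = z} z∈S⊞X = does≡true⇒ (any? _)
  (trans (sym (lookup∘tabulate _ z)) ([]=⇒lookup z∈S⊞X))

∈-⊞⁺ : {S X : Subset n} {s x : Fin n} → s ∈ S → x ∈ X → s ⊕ x ∈ S ⊞ X
∈-⊞⁺ {s = s} {x} s∈S x∈X = lookup⇒[]= (s ⊕ x) _
  (trans (lookup∘tabulate _ (s ⊕ x)) (dec-true (any? _) (s , x , s∈S , x∈X , refl)))

⊞-monoˡ-⊆ : {S T X : Subset n} → S ⊆ T → S ⊞ X ⊆ T ⊞ X
⊞-monoˡ-⊆ S⊆T z∈S⊞X with s , x , s∈S , x∈X , refl ← ∈-⊞⁻ z∈S⊞X = ∈-⊞⁺ (S⊆T s∈S) x∈X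

x∉p-x : (p : Subset n) (x : Fin n) → x ∉ p - x
x∉p-x (_ ∷ p) (suc x) (there x∈p-x) = x∉p-x p x x∈p-x

x∈p⇒∣p-x∣+1≡∣p∣ : {p : Subset n} {x : Fin n} → x ∈ p → suc ∣ p - x ∣ ≡ ∣ p ∣
x∈p⇒∣p-x∣+1≡∣p∣ {p = inside ∷ p} here = cong (suc ∘ ∣_∣) (p─⊥≡p p)
x∈p⇒∣p-x∣+1≡∣p∣ {p = outside ∷ _} (there x∈p) = x∈p⇒∣p-x∣+1≡∣p∣ x∈p
x∈p⇒∣p-x∣+1≡∣p∣ {p = inside ∷ _} (there x∈p) = cong suc (x∈p⇒∣p-x∣+1≡∣p∣ x∈p)

unique-summand⇒-⊞⊂ : {A X : Subset n} {a x z : Fin n} → a ∈ A → x ∈ X → a ⊕ x ≡ z →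
  ((a' x' : Fin n) → a' ∈ A → x' ∈ X → a' ⊕ x' ≡ z → a' ≡ a) →
  (A - a) ⊞ X ⊂ A ⊞ X
unique-summand⇒-⊞⊂ {A = A} {a = a} a∈A x∈X refl unique =
  ⊞-monoˡ-⊆ (p─q⊆p A _) , a ⊕ _ , ∈-⊞⁺ a∈A x∈X , a⊕x∉
  where
  a⊕x∉ : a ⊕ _ ∉ (A - a) ⊞ _
  a⊕x∉ z∈ with s , x' , s∈A-a , x'∈X , s⊕x'≡z ← ∈-⊞⁻ z∈ =
    x∉p-x A a (subst (_∈ A - a) (unique s x' (p─q⊆p A _ s∈A-a) x'∈X s⊕x'≡z) s∈A-a)

m<o⇒m-n≤o-[1+n] : {m o : ℕ} (n : ℕ) → m < o → + m ℤ.- + n ℤ.≤ + o ℤ.- + suc n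
m<o⇒m-n≤o-[1+n] {m} {o} n m<o = begin
  + m ℤ.- + n             ≡⟨ ℤ.m-n≡m⊖n m n ⟩
  m ℤ.⊖ n                 ≡⟨ ℤ.[1+m]⊖[1+n]≡m⊖n m n ⟨
  suc m ℤ.⊖ suc n         ≡⟨ ℤ.m-n≡m⊖n (suc m) (suc n) ⟨
  + suc m ℤ.- + suc n     ≤⟨ ℤ.+-monoˡ-≤ (ℤ.- + suc n) (+≤+ m<o) ⟩
  + o ℤ.- + suc n         ∎
  where open ℤ.≤-Reasoning

fragment-remove : {X A : Subset n} {k : ℕ} {a : Fin n} → IsFragment X k A →
  k < ∣ A ∣ → a ∈ A → (A - a) ⊞ X ⊂ A ⊞ X → IsFragment X k (A - a)
fragment-remove {X = X} {A} {k} {a} ((_ , ∣A⊞X∣+k≤n) , minimal) k<∣A∣ a∈A shrinks =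
  (k≤∣A-a∣ , ℕ.≤-trans (ℕ.+-monoˡ-≤ k (ℕ.<⇒≤ ∣⊞∣<)) ∣A⊞X∣+k≤n) ,
  λ T admissible → ℤ.≤-trans excess≤ (minimal T admissible)
  where
  ∣A∣≡ : suc ∣ A - a ∣ ≡ ∣ A ∣
  ∣A∣≡ = x∈p⇒∣p-x∣+1≡∣p∣ a∈A
  ∣⊞∣< : ∣ (A - a) ⊞ X ∣ < ∣ A ⊞ X ∣
  ∣⊞∣< = p⊂q⇒∣p∣<∣q∣ shrinks
  k≤∣A-a∣ : k ≤ ∣ A - a ∣
  k≤∣A-a∣ = ℕ.≤-pred (subst (k <_) (sym ∣A∣≡) k<∣A∣)
  excess≤ : excess X (A - a) ℤ.≤ excess X A
  excess≤ = subst (λ t → excess X (A - a) ℤ.≤ + ∣ A ⊞ X ∣ ℤ.- + t) ∣A∣≡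
    (m<o⇒m-n≤o-[1+n] ∣ A - a ∣ ∣⊞∣<)

lemma4p2 : (p : ℕ) → Prime p → (X : Subset p) → (k : ℕ) → k ≥ 1 →
    (A : Subset p) → IsAtom X k A →
    (∃ λ (z : Fin p) → z ∈ X ⊞ A × UniqueRep X A z) →
    ∣ A ∣ ≡ k
lemma4p2 p _ X k _ A (fragment@((k≤∣A∣ , _) , _) , smallest) (z , _ , x , a , (x∈X , a∈A , x⊕a≡z) , unique) =
  ℕ.≤-antisym (ℕ.≮⇒≥ k≮∣A∣) k≤∣A∣
  where
  unique-a : (a' x' : Fin p) → a' ∈ A → x' ∈ X → a' ⊕ x' ≡ z → a' ≡ a
  unique-a a' x' a'∈A x'∈X e = proj₂ (unique x' a' x'∈X a'∈A (trans (⊕-comm x' a') e))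
  k≮∣A∣ : ¬ k < ∣ A ∣
  k≮∣A∣ k<∣A∣ = ℕ.<⇒≱ (x∈p⇒∣p-x∣<∣p∣ a∈A) (smallest (A - a)
    (fragment-remove fragment k<∣A∣ a∈A
      (unique-summand⇒-⊞⊂ a∈A x∈X (trans (⊕-comm a x) x⊕a≡z) unique-a)))
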